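{- Let $t\ge 2$ and $p$ be integers with $2\le p\le 2t-1$ and let $k=2t+p-2$. Then $C_{p,p-1}$ is an isolation submatrix of size $(2p-1)\times(2p-1)$ of $A_{k,t}$. Furthermore, if $k\ge 4t-3$, then $C_{2t-1,k-2t+1}$ is an isolation submatrix of size $k\times k$ of $A_{k,t}$.
   Context: For positive integers $k,t$ with $k\ge t$, $A_{k,t}$ is the $0,1$-matrix of size $\binom{k}{t}\times\binom{k}{t}$ whose rows and columns are indexed by all $t$-element subsets of $[k]=\{1,\dots,k\}$, with entry $1$ in row $x$, column $y$ if and only if $x\cap y\neq\emptyset$. For integers $p\ge 1$, $q\ge 0$ and $n=p+q$, $C_{p,q}$ is the $n\times n$ circulant $0,1$-matrix whose entry in row $i$, column $j$ ($1\le i,j\le n$) is $1$ iff $(i-j) \bmod n \in\{0,1,\dots,p-1\}$. An $n\times m$ $0,1$-matrix $M$ is a submatrix of $A_{k,t}$ if there are distinct $t$-subsets $F_1,\dots,F_n$ of $[k]$ and distinct $t$-subsets $G_1,\dots,G_m$ of $[k]$ with $M_{ij}=1$ iff $F_i\cap G_j\ne\emptyset$. An $s\times s$ $0,1$-matrix $B$ is an isolation matrix if it contains $s$ entries equal to $1$, no two in the same row or column, and no two of which lie in a common $2\times 2$ all-one submatrix of $B$; an isolation submatrix of $A_{k,t}$ is a submatrix of $A_{k,t}$ that is an isolation matrix. -}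

module Defs where

open import Data.Bool using (Bool; true; false)
open import Data.Nat using (ℕ; zero; suc; _+_; _∸_; _<ᵇ_)
open import Data.Nat.DivMod using (_%_)
open import Data.Fin using (Fin; toℕ)
open import Data.Fin.Subset using (Subset; _∩_; ∣_∣; Nonempty)
open import Data.Product using (Σ; _×_)
open import Function.Definitions using (Injective)
open import Relation.Binary.PropositionalEquality using (_≡_)
open import Relation.Nullary using (¬_)
open import Function.Bundles using (_⇔_)

Matrix01 : ℕ → ℕ → Set
Matrix01 n m = Fin n → Fin m → Bool

diffMod : (n : ℕ) → Fin n → Fin n → ℕ
diffMod zero    ()  _
diffMod (suc n) i j = (toℕ i + suc n ∸ toℕ j) % suc n

-- The circulant matrix C_{p,q}: entry (i,j) is 1 iff (i - j) mod (p+q) ∈ {0,…,p-1}.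
-- (Shifting indices from 1..n to 0..n-1 does not change i - j.)
C : (p q : ℕ) → Matrix01 (p + q) (p + q)
C p q i j = diffMod (p + q) i j <ᵇ p

-- t-subsets of [k] are represented as subsets of Fin k with cardinality t.
-- M is a submatrix of A_{k,t}.
IsSubmatrixOfA : {n m : ℕ} → Matrix01 n m → (k t : ℕ) → Set
IsSubmatrixOfA {n} {m} M k t =
  Σ (Fin n → Subset k) λ F →
  Σ (Fin m → Subset k) λ G →
    ((i : Fin n) → ∣ F i ∣ ≡ t) ×
    ((j : Fin m) → ∣ G j ∣ ≡ t) ×
    Injective _≡_ _≡_ F ×
    Injective _≡_ _≡_ G ×
    ((i : Fin n) (j : Fin m) → (M i j ≡ true) ⇔ Nonempty (F i ∩ G j))

-- An s×s isolation matrix: s one-entries (i, σ i) with no two in the same row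
-- or column (σ injective), and no two lying in a common 2×2 all-one submatrix.
IsIsolationMatrix : {s : ℕ} → Matrix01 s s → Set
IsIsolationMatrix {s} B =
  Σ (Fin s → Fin s) λ σ →
    Injective _≡_ _≡_ σ ×
    ((i : Fin s) → B i (σ i) ≡ true) ×
    ((i i′ : Fin s) → ¬ (i ≡ i′) →
       ¬ ((B i (σ i) ≡ true) × (B i (σ i′) ≡ true) ×
          (B i′ (σ i) ≡ true) × (B i′ (σ i′) ≡ true)))

IsIsolationSubmatrixOfA : {s : ℕ} → Matrix01 s s → (k t : ℕ) → Set
IsIsolationSubmatrixOfA B k t = IsSubmatrixOfA B k t × IsIsolationMatrix B

-- Let n = a + b + 1 + q with
-- a + b ≤ q and view [0, n) as the n-cycle.  Row i of the circulant
-- C_{a+b+1, q} is represented by the arc of a + 1 points ending at i, column j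
-- by the arc of b + 1 points starting at j; two such arcs meet iff i lies at
-- most a + b steps after j, which is exactly the circulant's entry (i, j).
-- Padding the row sets with a block of s fresh points and the column sets with
-- a disjoint block of u fresh points makes all of them t-sets, where
-- t = a + 1 + s = b + 1 + u, inside [K] with K = n + s + u.  Since a + b ≤ q,
-- no two distinct i, i′ have ones at both (i, i′) and (i′, i), so the diagonal
-- is an isolating family of ones, and the realising families are injective.

module Submission where

open import Defs
open import Data.Bool using (Bool; true; false; if_then_else_; not)
open import Data.Bool.Properties using (T-≡; ¬-not)
open import Data.Empty using (⊥; ⊥-elim)
open import Data.Fin using (Fin; toℕ; fromℕ<)
open import Data.Fin.Properties using (toℕ<n; toℕ-fromℕ<; toℕ-injective) renaming (_≟_ to _≟ᶠ_)
open import Data.Fin.Subset using (Subset; _∩_; ∣_∣; Nonempty; _∈_)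
open import Data.Fin.Subset.Properties using (x∈p∩q⁺; x∈p∩q⁻)
open import Data.Nat using (ℕ; zero; suc; _+_; _*_; _∸_; _≤_; _<_; _<ᵇ_; _⊓_; s≤s; s≤s⁻¹; z<s; s<s; NonZero)
open import Data.Nat.DivMod using (_%_; m%n<n; m%n≤m; m<n⇒m%n≡m; [m+n]%n≡m%n; n%n≡0; %-distribˡ-+; m%n%n≡m%n)
open import Data.Nat.Properties
open import Data.Nat.Tactic.RingSolver using (solve-∀)
open import Data.Product using (_×_; ∃; _,_)
open import Data.Vec using (tabulate)
open import Data.Vec.Properties using (lookup∘tabulate; []=⇒lookup; lookup⇒[]=)
open import Function.Base using (_∘_)
open import Function.Bundles using (_⇔_; mk⇔; Equivalence)
open import Function.Construct.Composition using (_⇔-∘_)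
open import Function.Definitions using (Injective)
open import Relation.Binary using (tri<; tri≈; tri>)
open import Relation.Binary.PropositionalEquality
open import Relation.Nullary using (¬_; yes; no)

open ≡-Reasoning

<ᵇ-true : ∀ {m n} → m < n → (m <ᵇ n) ≡ true
<ᵇ-true {m} {n} m<n = Equivalence.to T-≡ (<⇒<ᵇ m<n)

<ᵇ-false : ∀ {m n} → n ≤ m → (m <ᵇ n) ≡ false
<ᵇ-false {m} {n} n≤m = ¬-not (λ m<ᵇn → <⇒≱ (<ᵇ⇒< m n (Equivalence.from T-≡ m<ᵇn)) n≤m)

<ᵇ-sound : ∀ {m n} → (m <ᵇ n) ≡ true → m < n
<ᵇ-sound {m} {n} m<ᵇn = <ᵇ⇒< m n (Equivalence.from T-≡ m<ᵇn)

if-below : ∀ {x n} {u v : Bool} → x < n → (if x <ᵇ n then u else v) ≡ u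
if-below {u = u} {v} x<n = cong (if_then u else v) (<ᵇ-true x<n)

if-above : ∀ {x n} {u v : Bool} → n ≤ x → (if x <ᵇ n then u else v) ≡ v
if-above {u = u} {v} n≤x = cong (if_then u else v) (<ᵇ-false n≤x)

indicator : Bool → ℕ
indicator true  = 1
indicator false = 0

countBelow : (ℕ → Bool) → ℕ → ℕ
countBelow f zero    = 0
countBelow f (suc m) = indicator (f 0) + countBelow (f ∘ suc) m

countBelow-cong : ∀ m (f g : ℕ → Bool) → (∀ x → x < m → f x ≡ g x) →
                  countBelow f m ≡ countBelow g m
countBelow-cong zero    f g f≗g = refl
countBelow-cong (suc m) f g f≗g =
  cong₂ _+_ (cong indicator (f≗g 0 z<s)) (countBelow-cong m _ _ (λ x x<m → f≗g (suc x) (s<s x<m)))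

countBelow-false : ∀ m → countBelow (λ _ → false) m ≡ 0
countBelow-false zero    = refl
countBelow-false (suc m) = countBelow-false m

countBelow-true : ∀ m → countBelow (λ _ → true) m ≡ m
countBelow-true zero    = refl
countBelow-true (suc m) = cong suc (countBelow-true m)

countBelow-+ : ∀ m l f → countBelow f (m + l) ≡ countBelow f m + countBelow (λ x → f (m + x)) l
countBelow-+ zero    l f = refl
countBelow-+ (suc m) l f = trans (cong (indicator (f 0) +_) (countBelow-+ m l (f ∘ suc)))
  (sym (+-assoc (indicator (f 0)) (countBelow (f ∘ suc) m) _))

countBelow-snoc : ∀ m f → countBelow f (suc m) ≡ countBelow f m + indicator (f m)
countBelow-snoc m f = begin
  countBelow f (suc m)                           ≡⟨ cong (countBelow f) (+-comm 1 m) ⟩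
  countBelow f (m + 1)                           ≡⟨ countBelow-+ m 1 f ⟩
  countBelow f m + (indicator (f (m + 0)) + 0)   ≡⟨ cong (λ y → countBelow f m + y)
                                                       (trans (+-identityʳ _) (cong (indicator ∘ f) (+-identityʳ m))) ⟩
  countBelow f m + indicator (f m)               ∎

countBelow-reverse : ∀ m f → countBelow (λ x → f (m ∸ suc x)) m ≡ countBelow f m
countBelow-reverse zero    f = refl
countBelow-reverse (suc m) f = begin
  indicator (f m) + countBelow (λ x → f (m ∸ suc x)) m ≡⟨ cong (indicator (f m) +_) (countBelow-reverse m f) ⟩
  indicator (f m) + countBelow f m                     ≡⟨ +-comm (indicator (f m)) _ ⟩
  countBelow f m + indicator (f m)                     ≡⟨ sym (countBelow-snoc m f) ⟩
  countBelow f (suc m)                                 ∎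

countBelow-initial : ∀ n a → a ≤ n → countBelow (_<ᵇ a) n ≡ a
countBelow-initial n       zero    _         = countBelow-false n
countBelow-initial (suc n) (suc a) (s≤s a≤n) = cong suc (countBelow-initial n a a≤n)

%-absorbˡ : ∀ m k n .{{_ : NonZero n}} → (m % n + k) % n ≡ (m + k) % n
%-absorbˡ m k n = begin
  (m % n + k) % n           ≡⟨ %-distribˡ-+ (m % n) k n ⟩
  (m % n % n + k % n) % n   ≡⟨ cong (λ y → (y + k % n) % n) (m%n%n≡m%n m n) ⟩
  (m % n + k % n) % n       ≡⟨ sym (%-distribˡ-+ m k n) ⟩
  (m + k) % n               ∎

countBelow-rotate₁ : ∀ m g → countBelow (λ x → g ((x + 1) % suc m)) (suc m) ≡ countBelow g (suc m)
countBelow-rotate₁ m g = begin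
  countBelow (λ x → g ((x + 1) % suc m)) (suc m)
    ≡⟨ countBelow-snoc m _ ⟩
  countBelow (λ x → g ((x + 1) % suc m)) m + indicator (g ((m + 1) % suc m))
    ≡⟨ cong₂ _+_ (countBelow-cong m _ _ (λ x x<m → cong g (inner x x<m))) (cong (indicator ∘ g) last) ⟩
  countBelow (g ∘ suc) m + indicator (g 0)
    ≡⟨ +-comm (countBelow (g ∘ suc) m) _ ⟩
  countBelow g (suc m) ∎
  where
  inner : ∀ x → x < m → (x + 1) % suc m ≡ suc x
  inner x x<m = trans (cong (_% suc m) (+-comm x 1)) (m<n⇒m%n≡m (s<s x<m))
  last : (m + 1) % suc m ≡ 0
  last = trans (cong (_% suc m) (+-comm m 1)) (n%n≡0 (suc m))

countBelow-rotate : ∀ n .{{_ : NonZero n}} c g → countBelow (λ x → g ((x + c) % n)) n ≡ countBelow g n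
countBelow-rotate (suc m) zero    g =
  countBelow-cong (suc m) _ _ (λ x x<n → cong g (trans (cong (_% suc m) (+-identityʳ x)) (m<n⇒m%n≡m x<n)))
countBelow-rotate (suc m) (suc c) g = begin
  countBelow (λ x → g ((x + suc c) % suc m)) (suc m)
    ≡⟨ countBelow-cong (suc m) _ _ (λ x _ → cong g (sym (step x))) ⟩
  countBelow (λ x → g (((x + 1) % suc m + c) % suc m)) (suc m)
    ≡⟨ countBelow-rotate₁ m (λ y → g ((y + c) % suc m)) ⟩
  countBelow (λ x → g ((x + c) % suc m)) (suc m)
    ≡⟨ countBelow-rotate (suc m) c g ⟩
  countBelow g (suc m) ∎
  where
  step : ∀ x → ((x + 1) % suc m + c) % suc m ≡ (x + suc c) % suc m
  step x = trans (%-absorbˡ (x + 1) c (suc m)) (cong (_% suc m) (+-assoc x 1 c))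

∣tabulate∣ : ∀ K (f : ℕ → Bool) → ∣ tabulate {n = K} (f ∘ toℕ) ∣ ≡ countBelow f K
∣tabulate∣ zero    f = refl
∣tabulate∣ (suc K) f with f 0
... | true  = cong suc (∣tabulate∣ K (f ∘ suc))
... | false = ∣tabulate∣ K (f ∘ suc)

∈-tabulate⁺ : ∀ {K} (f : Fin K → Bool) x → f x ≡ true → x ∈ tabulate f
∈-tabulate⁺ f x fx = lookup⇒[]= x (tabulate f) (trans (lookup∘tabulate f x) fx)

∈-tabulate⁻ : ∀ {K} (f : Fin K → Bool) x → x ∈ tabulate f → f x ≡ true
∈-tabulate⁻ f x x∈ = trans (sym (lookup∘tabulate f x)) ([]=⇒lookup x∈)

meet-tabulate : ∀ K (f g : ℕ → Bool) →
  Nonempty (tabulate {n = K} (f ∘ toℕ) ∩ tabulate (g ∘ toℕ)) ⇔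
  (∃ λ x → x < K × f x ≡ true × g x ≡ true)
meet-tabulate K f g = mk⇔ to from
  where
  to : Nonempty (tabulate (f ∘ toℕ) ∩ tabulate (g ∘ toℕ)) → ∃ λ x → x < K × f x ≡ true × g x ≡ true
  to (y , y∈) with x∈p∩q⁻ (tabulate (f ∘ toℕ)) (tabulate (g ∘ toℕ)) y∈
  ... | y∈F , y∈G = toℕ y , toℕ<n y , ∈-tabulate⁻ (f ∘ toℕ) y y∈F , ∈-tabulate⁻ (g ∘ toℕ) y y∈G
  from : (∃ λ x → x < K × f x ≡ true × g x ≡ true) → Nonempty (tabulate (f ∘ toℕ) ∩ tabulate (g ∘ toℕ))
  from (x , x<K , fx , gx) = fromℕ< x<K , x∈p∩q⁺ (member f fx , member g gx)
    where
    member : ∀ h → h x ≡ true → fromℕ< x<K ∈ tabulate (h ∘ toℕ)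
    member h hx = ∈-tabulate⁺ (h ∘ toℕ) (fromℕ< x<K) (trans (cong h (toℕ-fromℕ< x<K)) hx)

interchange : ∀ u x v y → (u + x) + (v + y) ≡ (u + y) + (x + v)
interchange = solve-∀

-- Cyclic distance on ℤ/n: δ x y = (x - y) mod n is how far x lies after y
-- when walking around the n-cycle.

module Cyclic (n : ℕ) .{{_ : NonZero n}} where

  δ : ℕ → ℕ → ℕ
  δ x y = (x + n ∸ y) % n

  δ<n : ∀ x y → δ x y < n
  δ<n x y = m%n<n (x + n ∸ y) n

  δ-self : ∀ x → δ x x ≡ 0
  δ-self x = trans (cong (_% n) (m+n∸m≡n x n)) (n%n≡0 n)

  δ-below : ∀ {x y} → y ≤ x → x < n → δ x y ≡ x ∸ y
  δ-below {x} {y} y≤x x<n = begin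
    (x + n ∸ y) % n   ≡⟨ cong (_% n) (+-∸-comm n y≤x) ⟩
    (x ∸ y + n) % n   ≡⟨ [m+n]%n≡m%n (x ∸ y) n ⟩
    (x ∸ y) % n       ≡⟨ m<n⇒m%n≡m (≤-<-trans (m∸n≤m x y) x<n) ⟩
    x ∸ y             ∎

  δ-above : ∀ {x y} → x < y → y ≤ n → δ x y ≡ x + (n ∸ y)
  δ-above {x} {y} x<y y≤n = trans (cong (_% n) (+-∸-assoc x y≤n)) (m<n⇒m%n≡m x+[n∸y]<n)
    where
    x+[n∸y]<n : x + (n ∸ y) < n
    x+[n∸y]<n = subst (x + (n ∸ y) <_) (m+[n∸m]≡n y≤n) (+-monoˡ-< (n ∸ y) x<y)

  δ-triangle : ∀ w v x → v ≤ n → x ≤ n → (δ w v + δ v x) % n ≡ δ w x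
  δ-triangle w v x v≤n x≤n = begin
    ((w + n ∸ v) % n + (v + n ∸ x) % n) % n   ≡⟨ sym (%-distribˡ-+ (w + n ∸ v) (v + n ∸ x) n) ⟩
    ((w + n ∸ v) + (v + n ∸ x)) % n           ≡⟨ cong (_% n) sum ⟩
    ((w + n ∸ x) + n) % n                     ≡⟨ [m+n]%n≡m%n (w + n ∸ x) n ⟩
    (w + n ∸ x) % n                           ∎
    where
    sum : (w + n ∸ v) + (v + n ∸ x) ≡ (w + n ∸ x) + n
    sum = begin
      (w + n ∸ v) + (v + n ∸ x)       ≡⟨ cong₂ _+_ (+-∸-assoc w v≤n) (+-∸-assoc v x≤n) ⟩
      (w + (n ∸ v)) + (v + (n ∸ x))   ≡⟨ interchange w (n ∸ v) v (n ∸ x) ⟩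
      (w + (n ∸ x)) + ((n ∸ v) + v)   ≡⟨ cong₂ _+_ (sym (+-∸-assoc w x≤n)) (m∸n+n≡m v≤n) ⟩
      (w + n ∸ x) + n                 ∎

  δ-opposite : ∀ {x y} → y < x → x < n → δ x y + δ y x ≡ n
  δ-opposite {x} {y} y<x x<n = begin
    δ x y + δ y x             ≡⟨ cong₂ _+_ (δ-below (<⇒≤ y<x) x<n) (δ-above y<x (<⇒≤ x<n)) ⟩
    (x ∸ y) + (y + (n ∸ x))   ≡⟨ sym (+-assoc (x ∸ y) y (n ∸ x)) ⟩
    (x ∸ y) + y + (n ∸ x)     ≡⟨ cong (_+ (n ∸ x)) (m∸n+n≡m (<⇒≤ y<x)) ⟩
    x + (n ∸ x)               ≡⟨ m+[n∸m]≡n (<⇒≤ x<n) ⟩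
    n                         ∎

  δ-reach : ∀ j c → j < n → c < n → ∃ λ x → x < n × δ x j ≡ c
  δ-reach j c j<n c<n with j + c <? n
  ... | yes j+c<n = j + c , j+c<n , trans (δ-below (m≤m+n j c) j+c<n) (m+n∸m≡n j c)
  ... | no  j+c≮n = x , <-trans x<j j<n , trans (δ-above x<j (<⇒≤ j<n)) (+-cancelʳ-≡ j _ c x+[n∸j]+j)
    where
    n≤j+c : n ≤ j + c
    n≤j+c = ≮⇒≥ j+c≮n
    x : ℕ
    x = j + c ∸ n
    x<j : x < j
    x<j = subst (x <_) (m+n∸n≡m j n) (∸-monoˡ-< (+-monoʳ-< j c<n) n≤j+c)
    x+[n∸j]+j : x + (n ∸ j) + j ≡ c + j
    x+[n∸j]+j = begin
      x + (n ∸ j) + j     ≡⟨ +-assoc x (n ∸ j) j ⟩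
      x + ((n ∸ j) + j)   ≡⟨ cong (x +_) (m∸n+n≡m (<⇒≤ j<n)) ⟩
      x + n               ≡⟨ m∸n+n≡m n≤j+c ⟩
      j + c               ≡⟨ +-comm j c ⟩
      c + j               ∎

  %-wrap : ∀ m → n ≤ m → m < n + n → m % n ≡ m ∸ n
  %-wrap m n≤m m<2n = begin
    m % n           ≡⟨ cong (_% n) (sym (m∸n+n≡m n≤m)) ⟩
    (m ∸ n + n) % n ≡⟨ [m+n]%n≡m%n (m ∸ n) n ⟩
    (m ∸ n) % n     ≡⟨ m<n⇒m%n≡m (m<n+o⇒m∸n<o m n m<2n) ⟩
    m ∸ n           ∎

  δ-split : ∀ {i j} c e → j < n → c + e ≡ δ i j → ∃ λ x → x < n × δ i x ≡ c × δ x j ≡ e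
  δ-split {i} {j} c e j<n c+e≡δij = split (δ-reach j e j<n e<n)
    where
    e<n : e < n
    e<n = ≤-<-trans (m≤n+m e c) (subst (_< n) (sym c+e≡δij) (δ<n i j))
    split : (∃ λ x → x < n × δ x j ≡ e) → ∃ λ x → x < n × δ i x ≡ c × δ x j ≡ e
    split (x , x<n , δxj≡e) = x , x<n , +-cancelʳ-≡ e _ _ δix+e≡c+e , δxj≡e
      where
      wrapped : (δ i x + e) % n ≡ c + e
      wrapped = begin
        (δ i x + e) % n       ≡⟨ cong (λ z → (δ i x + z) % n) (sym δxj≡e) ⟩
        (δ i x + δ x j) % n   ≡⟨ δ-triangle i x j (<⇒≤ x<n) (<⇒≤ j<n) ⟩
        δ i j                 ≡⟨ sym c+e≡δij ⟩
        c + e                 ∎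
      -- if the sum wrapped around, δ i x would have to be c + n ≥ n
      no-wrap : ¬ (n ≤ δ i x + e)
      no-wrap n≤sum = <⇒≱ (δ<n i x) (+-cancelʳ-≤ e n (δ i x) n+e≤δix+e)
        where
        unwrapped : (c + e) + n ≡ δ i x + e
        unwrapped = begin
          (c + e) + n           ≡⟨ cong (_+ n) (trans (sym wrapped) (%-wrap _ n≤sum (+-mono-< (δ<n i x) e<n))) ⟩
          (δ i x + e ∸ n) + n   ≡⟨ m∸n+n≡m n≤sum ⟩
          δ i x + e             ∎
        n+e≤δix+e : n + e ≤ δ i x + e
        n+e≤δix+e = subst (n + e ≤_) (trans (+-comm n (c + e)) unwrapped) (+-monoʳ-≤ n (m≤n+m e c))
      δix+e≡c+e : δ i x + e ≡ c + e
      δix+e≡c+e = trans (sym (m<n⇒m%n≡m (≰⇒> no-wrap))) wrapped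

  count-arc-ending : ∀ i m → m ≤ n → countBelow (λ x → δ i x <ᵇ m) n ≡ m
  count-arc-ending i m m≤n = begin
    countBelow (λ x → δ i x <ᵇ m) n                   ≡⟨ sym (countBelow-reverse n _) ⟩
    countBelow (λ y → δ i (n ∸ suc y) <ᵇ m) n         ≡⟨ countBelow-cong n _ _ (λ y y<n → cong (_<ᵇ m) (reflect y y<n)) ⟩
    countBelow (λ y → ((y + suc i) % n) <ᵇ m) n       ≡⟨ countBelow-rotate n (suc i) (_<ᵇ m) ⟩
    countBelow (_<ᵇ m) n                              ≡⟨ countBelow-initial n m m≤n ⟩
    m                                                 ∎
    where
    reflect : ∀ y → y < n → δ i (n ∸ suc y) ≡ (y + suc i) % n
    reflect y y<n = cong (_% n) (begin
      i + n ∸ (n ∸ suc y)     ≡⟨ +-∸-assoc i (m∸n≤m n (suc y)) ⟩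
      i + (n ∸ (n ∸ suc y))   ≡⟨ cong (i +_) (m∸[m∸n]≡n y<n) ⟩
      i + suc y               ≡⟨ +-comm i (suc y) ⟩
      suc y + i               ≡⟨ sym (+-suc y i) ⟩
      y + suc i               ∎)

  count-arc-starting : ∀ j m → j ≤ n → m ≤ n → countBelow (λ x → δ x j <ᵇ m) n ≡ m
  count-arc-starting j m j≤n m≤n = begin
    countBelow (λ x → δ x j <ᵇ m) n                   ≡⟨ countBelow-cong n _ _ (λ x _ → cong (λ z → (z % n) <ᵇ m) (+-∸-assoc x j≤n)) ⟩
    countBelow (λ x → ((x + (n ∸ j)) % n) <ᵇ m) n     ≡⟨ countBelow-rotate n (n ∸ j) (_<ᵇ m) ⟩
    countBelow (_<ᵇ m) n                              ≡⟨ countBelow-initial n m m≤n ⟩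
    m                                                 ∎

-- A square 0,1-matrix with ones on its diagonal that never has ones at both
-- (i, i′) and (i′, i) for i ≢ i′ is an isolation matrix: two diagonal ones
-- (i, i) and (i′, i′) would span a 2×2 all-one submatrix containing (i, i′)
-- and (i′, i).

HasUnitDiagonal : ∀ {s} → Matrix01 s s → Set
HasUnitDiagonal M = ∀ i → M i i ≡ true

IsAsymmetric : ∀ {s} → Matrix01 s s → Set
IsAsymmetric M = ∀ i i′ → i ≢ i′ → M i i′ ≡ true → M i′ i ≡ true → ⊥

diagonal-isolation : ∀ {s} (M : Matrix01 s s) → HasUnitDiagonal M → IsAsymmetric M → IsIsolationMatrix M
diagonal-isolation M diag asym =
  (λ i → i) , (λ eq → eq) , diag , λ i i′ i≢i′ (_ , Mii′ , Mi′i , _) → asym i i′ i≢i′ Mii′ Mi′i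

-- For M as above the
-- realising families are injective: F i ≡ F i′ (or G i ≡ G i′) with i ≢ i′
-- would transport the diagonal ones to ones at (i, i′) and (i′, i).

Realises : ∀ {s m k} → Matrix01 s m → (Fin s → Subset k) → (Fin m → Subset k) → Set
Realises M F G = ∀ i j → (M i j ≡ true) ⇔ Nonempty (F i ∩ G j)

module Realiser {s k} (M : Matrix01 s s) (F G : Fin s → Subset k)
                (realises : Realises M F G) (diag : HasUnitDiagonal M) (asym : IsAsymmetric M) where

  meets-diagonal : ∀ i → Nonempty (F i ∩ G i)
  meets-diagonal i = Equivalence.to (realises i i) (diag i)

  equal-rows : ∀ {x y} → F x ≡ F y → M x y ≡ true
  equal-rows {x} {y} Fx≡Fy =
    Equivalence.from (realises x y) (subst (λ S → Nonempty (S ∩ G y)) (sym Fx≡Fy) (meets-diagonal y))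

  equal-columns : ∀ {x y} → G x ≡ G y → M y x ≡ true
  equal-columns {x} {y} Gx≡Gy =
    Equivalence.from (realises y x) (subst (λ S → Nonempty (F y ∩ S)) (sym Gx≡Gy) (meets-diagonal y))

  rows-injective : Injective _≡_ _≡_ F
  rows-injective {i} {i′} Fi≡Fi′ with i ≟ᶠ i′
  ... | yes i≡i′ = i≡i′
  ... | no  i≢i′ = ⊥-elim (asym i i′ i≢i′ (equal-rows Fi≡Fi′) (equal-rows (sym Fi≡Fi′)))

  columns-injective : Injective _≡_ _≡_ G
  columns-injective {i} {i′} Gi≡Gi′ with i ≟ᶠ i′
  ... | yes i≡i′ = i≡i′
  ... | no  i≢i′ = ⊥-elim (asym i i′ i≢i′ (equal-columns (sym Gi≡Gi′)) (equal-columns Gi≡Gi′))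

-- It has a unit diagonal, and it
-- is asymmetric once c ≤ q, since the two distances between distinct points add
-- up to n = c + 1 + q > 2c.

module Circulant (c q : ℕ) where

  open Cyclic (suc c + q)

  C-true⇔ : ∀ i j → (C (suc c) q i j ≡ true) ⇔ δ (toℕ i) (toℕ j) < suc c
  C-true⇔ i j = mk⇔ <ᵇ-sound <ᵇ-true

  C-diagonal : HasUnitDiagonal (C (suc c) q)
  C-diagonal i = <ᵇ-true (subst (_< suc c) (sym (δ-self (toℕ i))) z<s)

  C-near : ∀ x y → C (suc c) q x y ≡ true → δ (toℕ x) (toℕ y) ≤ c
  C-near x y Cxy = s≤s⁻¹ (Equivalence.to (C-true⇔ x y) Cxy)

  short-distances : c ≤ q → ∀ {d d′} → d + d′ ≡ suc c + q → d ≤ c → d′ ≤ c → ⊥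
  short-distances c≤q d+d′≡n d≤c d′≤c =
    <-irrefl d+d′≡n (s≤s (≤-trans (+-mono-≤ d≤c d′≤c) (+-monoʳ-≤ c c≤q)))

  C-asymmetric : c ≤ q → IsAsymmetric (C (suc c) q)
  C-asymmetric c≤q i i′ i≢i′ Cii′ Ci′i with <-cmp (toℕ i) (toℕ i′)
  ... | tri< i<i′ _ _ = short-distances c≤q (δ-opposite i<i′ (toℕ<n i′)) (C-near i′ i Ci′i) (C-near i i′ Cii′)
  ... | tri≈ _ i≡i′ _ = i≢i′ (toℕ-injective i≡i′)
  ... | tri> _ _ i′<i = short-distances c≤q (δ-opposite i′<i (toℕ<n i)) (C-near i i′ Cii′) (C-near i′ i Ci′i)

-- Put c = a + b, n = c + 1 + q and K = n + s + u, and split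
-- [K] into the cycle [0, n), a first block [n, n + s) and a second block
-- [n + s, K).  Row i and column j of C_{c+1, q} become the sets
--   F i = {x < n : x lies at most a steps before i} ∪ first block,
--   G j = {x < n : x lies at most b steps after j}  ∪ second block,
-- of sizes a + 1 + s and b + 1 + u.  They can only meet on the cycle, and
-- there they meet iff i lies at most a + b steps after j, i.e. iff the
-- circulant has a one at (i, j).

pads-disjoint : ∀ (v : Bool) → (if v then true else false) ≡ true → (if v then false else true) ≡ true → ⊥
pads-disjoint true  _  ()
pads-disjoint false () _

module Construction (a b q s u : ℕ) where

  n : ℕ
  n = suc (a + b) + q

  K : ℕ
  K = n + s + u

  open Cyclic n

  membership : (ℕ → Bool) → Bool → ℕ → Bool
  membership onCycle pad x = if x <ᵇ n then onCycle x else (if x <ᵇ n + s then pad else not pad)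

  count-membership : ∀ onCycle pad → countBelow (membership onCycle pad) K ≡
    countBelow onCycle n + countBelow (λ _ → pad) s + countBelow (λ _ → not pad) u
  count-membership onCycle pad = begin
    countBelow f (n + s + u)                                                  ≡⟨ countBelow-+ (n + s) u f ⟩
    countBelow f (n + s) + countBelow (λ x → f (n + s + x)) u                 ≡⟨ cong₂ _+_ (countBelow-+ n s f) second ⟩
    countBelow f n + countBelow (λ x → f (n + x)) s + countBelow (λ _ → not pad) u
                                                                             ≡⟨ cong (λ z → z + countBelow (λ _ → not pad) u) (cong₂ _+_ cycle first) ⟩
    countBelow onCycle n + countBelow (λ _ → pad) s + countBelow (λ _ → not pad) u ∎
    where
    f : ℕ → Bool
    f = membership onCycle pad
    cycle : countBelow f n ≡ countBelow onCycle n
    cycle = countBelow-cong n f onCycle (λ x x<n → if-below x<n)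
    first : countBelow (λ x → f (n + x)) s ≡ countBelow (λ _ → pad) s
    first = countBelow-cong s _ _ (λ x x<s → trans (if-above (m≤m+n n x)) (if-below (+-monoʳ-< n x<s)))
    second : countBelow (λ x → f (n + s + x)) u ≡ countBelow (λ _ → not pad) u
    second = countBelow-cong u _ _ (λ x _ →
      trans (if-above (≤-trans (m≤m+n n s) (m≤m+n (n + s) x))) (if-above (m≤m+n (n + s) x)))

  arcF : ℕ → ℕ → Bool
  arcF i x = δ i x <ᵇ suc a

  arcG : ℕ → ℕ → Bool
  arcG j x = δ x j <ᵇ suc b

  in-arc-ending : ∀ i x → arcF i x ≡ true → δ i x ≤ a
  in-arc-ending i x in-arc = s≤s⁻¹ (<ᵇ-sound in-arc)

  in-arc-starting : ∀ j x → arcG j x ≡ true → δ x j ≤ b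
  in-arc-starting j x in-arc = s≤s⁻¹ (<ᵇ-sound in-arc)

  F : Fin n → Subset K
  F i = tabulate (membership (arcF (toℕ i)) true ∘ toℕ)

  G : Fin n → Subset K
  G j = tabulate (membership (arcG (toℕ j)) false ∘ toℕ)

  ∣F∣ : ∀ i → ∣ F i ∣ ≡ suc a + s
  ∣F∣ i = begin
    ∣ F i ∣                                              ≡⟨ ∣tabulate∣ K (membership (arcF (toℕ i)) true) ⟩
    countBelow (membership (arcF (toℕ i)) true) K        ≡⟨ count-membership (arcF (toℕ i)) true ⟩
    countBelow (arcF (toℕ i)) n + countBelow (λ _ → true) s + countBelow (λ _ → false) u
      ≡⟨ cong₂ _+_ (cong₂ _+_ (count-arc-ending (toℕ i) (suc a) (s≤s (≤-trans (m≤m+n a b) (m≤m+n (a + b) q))))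
                              (countBelow-true s))
                   (countBelow-false u) ⟩
    suc a + s + 0                                        ≡⟨ +-identityʳ (suc a + s) ⟩
    suc a + s                                            ∎

  ∣G∣ : ∀ j → ∣ G j ∣ ≡ suc b + u
  ∣G∣ j = begin
    ∣ G j ∣                                              ≡⟨ ∣tabulate∣ K (membership (arcG (toℕ j)) false) ⟩
    countBelow (membership (arcG (toℕ j)) false) K       ≡⟨ count-membership (arcG (toℕ j)) false ⟩
    countBelow (arcG (toℕ j)) n + countBelow (λ _ → false) s + countBelow (λ _ → true) u
      ≡⟨ cong₂ _+_ (cong₂ _+_ (count-arc-starting (toℕ j) (suc b) (<⇒≤ (toℕ<n j)) (s≤s (≤-trans (m≤n+m b a) (m≤m+n (a + b) q))))
                              (countBelow-false s))
                   (countBelow-true u) ⟩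
    suc b + 0 + u                                        ≡⟨ cong (_+ u) (+-identityʳ (suc b)) ⟩
    suc b + u                                            ∎

  -- Outside the cycle the two kinds of sets are complementary.
  common-on-cycle : ∀ f g x → membership f true x ≡ true → membership g false x ≡ true →
                    x < n × f x ≡ true × g x ≡ true
  common-on-cycle f g x in₁ in₂ with x <? n
  ... | yes x<n = x<n , trans (sym (if-below x<n)) in₁ , trans (sym (if-below x<n)) in₂
  ... | no  x≮n = ⊥-elim (pads-disjoint (x <ᵇ n + s) (trans (sym (if-above (≮⇒≥ x≮n))) in₁)
                                                   (trans (sym (if-above (≮⇒≥ x≮n))) in₂))

  arcs-meet⇔ : ∀ i j → j < n →
    (δ i j < suc (a + b)) ⇔ (∃ λ x → x < n × arcF i x ≡ true × arcG j x ≡ true)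
  arcs-meet⇔ i j j<n = mk⇔ near⇒meet meet⇒near
    where
    near⇒meet : δ i j < suc (a + b) → ∃ λ x → x < n × arcF i x ≡ true × arcG j x ≡ true
    near⇒meet δij≤a+b with δ-split (a ⊓ δ i j) (δ i j ∸ a) j<n (m⊓n+n∸m≡n a (δ i j))
    ... | x , x<n , δix≡ , δxj≡ =
      x , x<n , <ᵇ-true (s≤s (subst (_≤ a) (sym δix≡) (m⊓n≤m a (δ i j))))
              , <ᵇ-true (s≤s (subst (_≤ b) (sym δxj≡) (m≤n+o⇒m∸n≤o (δ i j) a (s≤s⁻¹ δij≤a+b))))
    meet⇒near : (∃ λ x → x < n × arcF i x ≡ true × arcG j x ≡ true) → δ i j < suc (a + b)
    meet⇒near (x , x<n , in-arcF , in-arcG) =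
      s≤s (subst (_≤ a + b) (δ-triangle i x j (<⇒≤ x<n) (<⇒≤ j<n))
                 (≤-trans (m%n≤m (δ i x + δ x j) n)
                          (+-mono-≤ (in-arc-ending i x in-arcF) (in-arc-starting j x in-arcG))))

  meet⇔ : ∀ i j → (δ (toℕ i) (toℕ j) < suc (a + b)) ⇔ Nonempty (F i ∩ G j)
  meet⇔ i j = mk⇔ (λ near → Equivalence.from (meet-tabulate K _ _) (to-sets (Equivalence.to arcs near)))
                  (λ common → Equivalence.from arcs (to-arcs (Equivalence.to (meet-tabulate K _ _) common)))
    where
    arcs = arcs-meet⇔ (toℕ i) (toℕ j) (toℕ<n j)
    to-sets : (∃ λ x → x < n × arcF (toℕ i) x ≡ true × arcG (toℕ j) x ≡ true) →
              ∃ λ x → x < K × membership (arcF (toℕ i)) true x ≡ true × membership (arcG (toℕ j)) false x ≡ true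
    to-sets (x , x<n , in-arcF , in-arcG) =
      x , ≤-trans x<n (≤-trans (m≤m+n n s) (m≤m+n (n + s) u)) , trans (if-below x<n) in-arcF , trans (if-below x<n) in-arcG
    to-arcs : (∃ λ x → x < K × membership (arcF (toℕ i)) true x ≡ true × membership (arcG (toℕ j)) false x ≡ true) →
              ∃ λ x → x < n × arcF (toℕ i) x ≡ true × arcG (toℕ j) x ≡ true
    to-arcs (x , _ , in-F , in-G) = x , common-on-cycle (arcF (toℕ i)) (arcG (toℕ j)) x in-F in-G

circulant-isolation : ∀ a b q s u → suc b + u ≡ suc a + s → a + b ≤ q →
  IsIsolationSubmatrixOfA (C (suc (a + b)) q) (suc (a + b) + q + s + u) (suc a + s)
circulant-isolation a b q s u same-size a+b≤q =
  (F , G , ∣F∣ , (λ j → trans (∣G∣ j) same-size) , rows-injective , columns-injective , realises)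
  , diagonal-isolation (C (suc (a + b)) q) C-diagonal (C-asymmetric a+b≤q)
  where
  open Construction a b q s u
  open Circulant (a + b) q
  realises : Realises (C (suc (a + b)) q) F G
  realises i j = meet⇔ i j ⇔-∘ C-true⇔ i j
  open Realiser (C (suc (a + b)) q) F G realises C-diagonal (C-asymmetric a+b≤q)

-- The lemma with its parameters given up to equality, for instantiation.
circulant-isolation′ : ∀ {p q k t} a b s u → p ≡ suc (a + b) → k ≡ p + q + s + u →
  t ≡ suc a + s → suc b + u ≡ t → a + b ≤ q → IsIsolationSubmatrixOfA (C p q) k t
circulant-isolation′ a b s u refl refl refl same-size a+b≤q = circulant-isolation a b _ s u same-size a+b≤q

2t-1≡ : ∀ t₁ → 2 * suc t₁ ∸ 1 ≡ suc (t₁ + t₁)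
2t-1≡ t₁ = trans (+-suc t₁ (t₁ + 0)) (cong (suc ∘ (t₁ +_)) (+-identityʳ t₁))

4t-3≡ : ∀ t₁ → 4 * suc t₁ ∸ 3 ≡ suc (t₁ + t₁) + (t₁ + t₁)
4t-3≡ t₁ = cong (_∸ 3) (expand t₁)
  where
  expand : ∀ t₁ → 4 * suc t₁ ≡ 3 + (suc (t₁ + t₁) + (t₁ + t₁))
  expand = solve-∀

excess-bound : ∀ t₁ e → suc (t₁ + e) ≤ 2 * suc t₁ ∸ 1 → e ≤ t₁
excess-bound t₁ e p≤2t-1 = +-cancelˡ-≤ t₁ e t₁ (s≤s⁻¹ (subst (suc (t₁ + e) ≤_) (2t-1≡ t₁) p≤2t-1))

-- Width p ≤ t: take a = 0 and b = p - 1, so F i meets the cycle only in i.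
narrow-width : ∀ p₁ r →
  IsIsolationSubmatrixOfA (C (suc p₁) p₁) (2 * (suc p₁ + r) + suc p₁ ∸ 2) (suc p₁ + r)
narrow-width p₁ r = circulant-isolation′ 0 p₁ (p₁ + r) r refl (cong (_∸ 2) (size p₁ r)) refl refl ≤-refl
  where
  size : ∀ p₁ r → 2 * (suc p₁ + r) + suc p₁ ≡ 2 + (suc p₁ + p₁ + (p₁ + r) + r)
  size = solve-∀

-- Width p = t + a with a < t, t = a + s + 1: take b = t - 1 and no second block.
wide-width : ∀ a s →
  IsIsolationSubmatrixOfA (C (suc (a + s + a)) (a + s + a)) (2 * suc (a + s) + suc (a + s + a) ∸ 2) (suc (a + s))
wide-width a s = circulant-isolation′ a (a + s) s 0 (cong suc (+-comm (a + s) a)) (cong (_∸ 2) (size a s))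
                   refl (+-identityʳ (suc (a + s))) (≤-reflexive (+-comm a (a + s)))
  where
  size : ∀ a s → 2 * suc (a + s) + suc (a + s + a) ≡ 2 + (suc (a + s + a) + (a + s + a) + s + 0)
  size = solve-∀

circulant-p,p-1 : (t p : ℕ) → 2 ≤ t → 2 ≤ p → p ≤ 2 * t ∸ 1 →
  IsIsolationSubmatrixOfA (C p (p ∸ 1)) (2 * t + p ∸ 2) t
circulant-p,p-1 t p _ _ _ with p ≤? t
circulant-p,p-1 t (suc p₁) _ (s≤s _) _ | yes p≤t with m≤n⇒∃[o]m+o≡n p≤t
... | r , refl = narrow-width p₁ r
circulant-p,p-1 (suc t₁) (suc p₁) (s≤s _) (s≤s _) p≤2t-1 | no p≰t
  with m≤n⇒∃[o]m+o≡n (s≤s⁻¹ (<⇒≤ (≰⇒> p≰t)))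
... | a , refl with m≤n⇒∃[o]m+o≡n (excess-bound t₁ a p≤2t-1)
... | s , refl = wide-width a s

-- Second part: C_{2t-1, k-2t+1} in A_{k,t} for k ≥ 4t - 3, with a = b = t - 1
-- and no padding blocks.
circulant-2t-1 : (t k : ℕ) → 2 ≤ t → 4 * t ∸ 3 ≤ k →
  IsIsolationSubmatrixOfA (C (2 * t ∸ 1) (k ∸ (2 * t ∸ 1))) k t
circulant-2t-1 (suc t₁) k (s≤s _) 4t-3≤k =
  circulant-isolation′ t₁ t₁ 0 0 (2t-1≡ t₁) size (sym (+-identityʳ (suc t₁))) (+-identityʳ (suc t₁)) room
  where
  p : ℕ
  p = 2 * suc t₁ ∸ 1
  p+2t-2≤k : p + (t₁ + t₁) ≤ k
  p+2t-2≤k = subst (λ z → z + (t₁ + t₁) ≤ k) (sym (2t-1≡ t₁)) (subst (_≤ k) (4t-3≡ t₁) 4t-3≤k)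
  room : t₁ + t₁ ≤ k ∸ p
  room = subst (_≤ k ∸ p) (m+n∸m≡n p (t₁ + t₁)) (∸-monoˡ-≤ p p+2t-2≤k)
  size : k ≡ p + (k ∸ p) + 0 + 0
  size = begin
    k                     ≡⟨ sym (m+[n∸m]≡n (≤-trans (m≤m+n p (t₁ + t₁)) p+2t-2≤k)) ⟩
    p + (k ∸ p)           ≡⟨ sym (+-identityʳ _) ⟩
    p + (k ∸ p) + 0       ≡⟨ sym (+-identityʳ _) ⟩
    p + (k ∸ p) + 0 + 0   ∎

mainTheorem6 :
    ((t p : ℕ) → 2 ≤ t → 2 ≤ p → p ≤ 2 * t ∸ 1 →
      IsIsolationSubmatrixOfA (C p (p ∸ 1)) (2 * t + p ∸ 2) t)
    ×
    ((t k : ℕ) → 2 ≤ t → 4 * t ∸ 3 ≤ k →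
      IsIsolationSubmatrixOfA (C (2 * t ∸ 1) (k ∸ (2 * t ∸ 1))) k t)
mainTheorem6 = circulant-p,p-1 , circulant-2t-1
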